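{- Let $k\geq 2$ be an integer. If there exists a pseudo $k$-regular graph on $n$ vertices which has $k-1$ (distinct) edges each of whose two end vertices have degree $k$, then for every positive integer $m$ there exists a pseudo $k$-regular graph on $n+m(k-1)$ vertices.
   Context: All graphs are finite, simple and without isolated vertices. For a vertex $i$, $d_i$ is its degree and $m_i=d_i^{ -1}\sum_{j:\, ji\in E(G)} d_j$ is its average $2$-degree. A graph is $k$-harmonic if $m_i=k$ for all vertices $i$; it is pseudo $k$-regular if it is $k$-harmonic but not $k$-regular. -}

module Defs where

open import Data.Nat using (ℕ; _+_; _*_; _≤_; _<_; _≥_)
open import Data.Bool using (Bool; true; false)
open import Data.Fin using (Fin; toℕ)
open import Data.Product using (Σ; ∃; _×_; _,_; proj₁; proj₂)
open import Data.Vec.Functional using (foldr)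
open import Relation.Binary.PropositionalEquality using (_≡_; _≢_)
open import Relation.Nullary using (¬_)
open import Function.Definitions using (Injective)

record Graph (n : ℕ) : Set where
  field
    adj   : Fin n → Fin n → Bool
    sym   : ∀ i j → adj i j ≡ adj j i
    irrefl : ∀ i → adj i i ≡ false
open Graph public

Σ[_] : {n : ℕ} → (Fin n → ℕ) → ℕ
Σ[_] f = foldr _+_ 0 f

_⊙_ : Bool → ℕ → ℕ
true  ⊙ x = x
false ⊙ x = 0

deg : {n : ℕ} → Graph n → Fin n → ℕ
deg G i = Σ[ (λ j → adj G i j ⊙ 1) ]

-- sum of the degrees of the neighbours of i  ( = d_i * m_i )
nbrDegSum : {n : ℕ} → Graph n → Fin n → ℕ
nbrDegSum G i = Σ[ (λ j → adj G i j ⊙ deg G j) ]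

NoIsolated : {n : ℕ} → Graph n → Set
NoIsolated G = ∀ i → 1 ≤ deg G i

-- k-harmonic: m_i = k for all i, i.e. sum of neighbour degrees = k * d_i
-- (equivalent to m_i = k since d_i ≥ 1 for graphs without isolated vertices)
Harmonic : {n : ℕ} → ℕ → Graph n → Set
Harmonic k G = ∀ i → nbrDegSum G i ≡ k * deg G i

Regular : {n : ℕ} → ℕ → Graph n → Set
Regular k G = ∀ i → deg G i ≡ k

-- pseudo k-regular graph (graphs in the paper have no isolated vertices)
PseudoRegular : {n : ℕ} → ℕ → Graph n → Set
PseudoRegular k G = NoIsolated G × Harmonic k G × ¬ Regular k G

DegKEdge : {n : ℕ} → ℕ → Graph n → Set
DegKEdge {n} k G =
  Σ (Fin n) λ u → Σ (Fin n) λ v →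
    (toℕ u < toℕ v) × (adj G u v ≡ true) × (deg G u ≡ k) × (deg G v ≡ k)

edgeOf : {n : ℕ} {k : ℕ} {G : Graph n} → DegKEdge k G → Fin n × Fin n
edgeOf (u , v , _) = u , v

HasDistinctDegKEdges : {n : ℕ} → ℕ → ℕ → Graph n → Set
HasDistinctDegKEdges {n} r k G =
  Σ (Fin r → DegKEdge k G) λ e → Injective _≡_ _≡_ (λ i → edgeOf {n} {k} {G} (e i))

module Submission where

-- Extending a pseudo k-regular graph by k - 1 vertices (write k = r + 1).
--
-- Let G be pseudo (r+1)-regular with r distinct edges u_i v_i whose ends all
-- have degree r + 1.  Delete these r edges, add r new vertices w_i forming a
-- clique, and join w_i to u_i and v_i.  Every old vertex x loses one neighbour
-- for each deleted edge at x and gains the corresponding w_i instead, so its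
-- degree is unchanged; as every deleted neighbour and every new neighbour has
-- degree r + 1, the sum of the neighbour degrees of x is unchanged as well.
-- Each w_i has degree 2 + (r - 1) = r + 1 and all its neighbours have degree
-- r + 1.  Hence the new graph is again pseudo (r+1)-regular, and the edges
-- u_i w_i are r distinct edges between vertices of degree r + 1, so the step
-- can be repeated; m steps add m(k - 1) vertices.

open import Defs
open import Data.Nat using (ℕ; zero; suc; _+_; _*_; _∸_; _≤_; _<_; z≤n; s≤s)
import Data.Nat as ℕ
import Data.Nat.Properties as ℕₚ
open import Data.Bool using (Bool; true; false; _∧_; _∨_; not)
open import Data.Bool.Properties using (¬-not; not-¬)
open import Data.Fin using (Fin; zero; suc; toℕ; _↑ˡ_; _↑ʳ_; splitAt)
open import Data.Fin.Properties
  using (_≟_; 0≢1+n; suc-injective; toℕ-↑ˡ; toℕ-↑ʳ; toℕ<n; ↑ʳ-injective; splitAt-↑ˡ; splitAt-↑ʳ; splitAt⁻¹-↑ˡ; splitAt⁻¹-↑ʳ)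
open import Data.Sum using (_⊎_; inj₁; inj₂)
open import Data.Product using (Σ; _×_; _,_; proj₁; proj₂)
open import Data.Empty using (⊥; ⊥-elim)
open import Relation.Nullary using (¬_; Dec; yes; no; does)
open import Relation.Nullary.Decidable using (_⊎-dec_; _×-dec_; dec-true; dec-false; does-⇔)
open import Relation.Binary.PropositionalEquality
  using (_≡_; _≢_; refl; cong; cong₂; trans; subst; subst₂; module ≡-Reasoning)
  renaming (sym to ≡-sym)
open import Function.Bundles using (mk⇔)
open import Function.Definitions using (Injective)
open import Algebra.Properties.Semiring.Sum ℕₚ.+-*-semiring
  using (sum-cong-≗; ∑-distrib-+; ∑-comm; *-distribʳ-sum; sum-replicate-zero)

from-does : ∀ {A : Set} (a? : Dec A) → does a? ≡ true → A
from-does (yes a) _ = a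
from-does (no _) ()

Σ-count : ∀ {n} → Σ[ (λ (_ : Fin n) → 1) ] ≡ n
Σ-count {zero}  = refl
Σ-count {suc n} = cong suc (Σ-count {n})

Σ-split : ∀ n {r} (f : Fin (n + r) → ℕ) →
  Σ[ f ] ≡ Σ[ (λ y → f (y ↑ˡ r)) ] + Σ[ (λ j → f (n ↑ʳ j)) ]
Σ-split zero    f = refl
Σ-split (suc n) f =
  trans (cong (f zero +_) (Σ-split n (λ y → f (suc y)))) (≡-sym (ℕₚ.+-assoc (f zero) _ _))

∨-⊙-disjoint : ∀ a b → (a ≡ true → b ≡ true → ⊥) → (a ∨ b) ⊙ 1 ≡ (a ⊙ 1) + (b ⊙ 1)
∨-⊙-disjoint true  true  disjoint = ⊥-elim (disjoint refl refl)
∨-⊙-disjoint true  false _        = refl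
∨-⊙-disjoint false b     _        = refl

⊙-scale : ∀ b c → (b ⊙ 1) * c ≡ b ⊙ c
⊙-scale true  c = ℕₚ.+-identityʳ c
⊙-scale false c = refl

Σ-none : ∀ {n} (b : Fin n → Bool) (w : Fin n → ℕ) → (∀ i → b i ≡ false) →
  Σ[ (λ i → b i ⊙ w i) ] ≡ 0
Σ-none {n} b w none = trans (sum-cong-≗ (λ i → cong (_⊙ w i) (none i))) (sum-replicate-zero n)

Σ-single : ∀ {n} (b : Fin n → Bool) (w : Fin n → ℕ) (v : Fin n) →
  (∀ y → b y ≡ true → y ≡ v) → b v ≡ true → Σ[ (λ y → b y ⊙ w y) ] ≡ w v
Σ-single b w zero only bv =
  trans (cong₂ _+_ (cong (_⊙ w zero) bv)
                   (Σ-none (λ y → b (suc y)) (λ y → w (suc y))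
                           (λ y → ¬-not (λ p → 0≢1+n (≡-sym (only (suc y) p))))))
        (ℕₚ.+-identityʳ (w zero))
Σ-single b w (suc v) only bv =
  cong₂ _+_ (cong (_⊙ w zero) (¬-not (λ p → 0≢1+n (only zero p))))
            (Σ-single (λ y → b (suc y)) (λ y → w (suc y)) v
                      (λ y p → suc-injective (only (suc y) p)) bv)

Σ-atMostOne : ∀ {n} (b : Fin n → Bool) → (∀ i j → b i ≡ true → b j ≡ true → i ≡ j) →
  Σ[ (λ i → b i ⊙ 1) ] ≤ 1
Σ-atMostOne {zero}  b unique = z≤n
Σ-atMostOne {suc n} b unique with b zero in b₀
... | true  = subst (λ t → 1 + t ≤ 1) (≡-sym (Σ-none (λ y → b (suc y)) (λ _ → 1) rest-false)) ℕₚ.≤-refl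
  where
  rest-false : ∀ y → b (suc y) ≡ false
  rest-false y = ¬-not (λ p → 0≢1+n (unique zero (suc y) b₀ p))
... | false = Σ-atMostOne (λ y → b (suc y)) (λ i j p q → suc-injective (unique (suc i) (suc j) p q))

Σ-constant-on-support : ∀ {n} (b : Fin n → Bool) (w : Fin n → ℕ) c →
  (∀ i → b i ≡ true → w i ≡ c) → Σ[ (λ i → b i ⊙ w i) ] ≡ Σ[ (λ i → b i ⊙ 1) ] * c
Σ-constant-on-support b w c const =
  trans (sum-cong-≗ pointwise) (≡-sym (*-distribʳ-sum c (λ i → b i ⊙ 1)))
  where
  pointwise : ∀ i → b i ⊙ w i ≡ (b i ⊙ 1) * c
  pointwise i with b i in eq
  ... | true  = trans (const i eq) (≡-sym (ℕₚ.+-identityʳ c))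
  ... | false = refl

Σ-point : ∀ {n} (v : Fin n) → Σ[ (λ y → does (v ≟ y) ⊙ 1) ] ≡ 1
Σ-point v = Σ-single (λ y → does (v ≟ y)) (λ _ → 1) v (λ y p → ≡-sym (from-does (v ≟ y) p)) (dec-true (v ≟ v) refl)

Σ-others : ∀ {r} (i : Fin r) → suc Σ[ (λ j → not (does (i ≟ j)) ⊙ 1) ] ≡ r
Σ-others {r} i = begin
  suc Σ[ (λ j → not (does (i ≟ j)) ⊙ 1) ]
    ≡⟨ cong (_+ Σ[ (λ j → not (does (i ≟ j)) ⊙ 1) ]) (≡-sym (Σ-point i)) ⟩
  Σ[ (λ j → does (i ≟ j) ⊙ 1) ] + Σ[ (λ j → not (does (i ≟ j)) ⊙ 1) ]
    ≡⟨ ≡-sym (∑-distrib-+ (λ j → does (i ≟ j) ⊙ 1) (λ j → not (does (i ≟ j)) ⊙ 1)) ⟩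
  Σ[ (λ j → (does (i ≟ j) ⊙ 1) + (not (does (i ≟ j)) ⊙ 1)) ]
    ≡⟨ sum-cong-≗ (λ j → excluded-middle (does (i ≟ j))) ⟩
  Σ[ (λ (_ : Fin r) → 1) ]
    ≡⟨ Σ-count ⟩
  r ∎
  where
  open ≡-Reasoning
  excluded-middle : ∀ b → (b ⊙ 1) + (not b ⊙ 1) ≡ 1
  excluded-middle true  = refl
  excluded-middle false = refl

-- The neighbourhood sum Σ_{y ~ x} w y of a weight w; deg and nbrDegSum are the
-- instances w = 1 and w = deg.
nbrSum : ∀ {t} → Graph t → Fin t → (Fin t → ℕ) → ℕ
nbrSum G x w = Σ[ (λ y → adj G x y ⊙ w y) ]

nbrDegSum-constant : ∀ {t} (G : Graph t) x k → (∀ y → adj G x y ≡ true → deg G y ≡ k) →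
  nbrDegSum G x ≡ k * deg G x
nbrDegSum-constant G x k nbrs-deg-k =
  trans (Σ-constant-on-support (adj G x) (deg G) k nbrs-deg-k) (ℕₚ.*-comm (deg G x) k)

-- The expansion of G along r distinct edges u_i v_i (stored with u_i < v_i):
-- the vertices are Fin n ⊎ Fin r, laid out as Fin (n + r).
module Expansion {n r : ℕ} (G : Graph n) (u v : Fin r → Fin n)
  (u<v : ∀ i → toℕ (u i) < toℕ (v i))
  (edge : ∀ i → adj G (u i) (v i) ≡ true)
  (distinct : Injective _≡_ _≡_ (λ i → (u i , v i))) where

  u≢v : ∀ i → u i ≢ v i
  u≢v i u≡v = ℕₚ.<-irrefl (cong toℕ u≡v) (u<v i)

  IsEnd : Fin r → Fin n → Set
  IsEnd i x = u i ≡ x ⊎ v i ≡ x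

  isEnd? : ∀ i x → Dec (IsEnd i x)
  isEnd? i x = (u i ≟ x) ⊎-dec (v i ≟ x)

  isEnd : Fin r → Fin n → Bool
  isEnd i x = does (isEnd? i x)

  Joins : Fin r → Fin n → Fin n → Set
  Joins i x y = (x ≡ u i × y ≡ v i) ⊎ (x ≡ v i × y ≡ u i)

  joins? : ∀ i x y → Dec (Joins i x y)
  joins? i x y = ((x ≟ u i) ×-dec (y ≟ v i)) ⊎-dec ((x ≟ v i) ×-dec (y ≟ u i))

  joins : Fin r → Fin n → Fin n → Bool
  joins i x y = does (joins? i x y)

  Joins-flip : ∀ {i x y} → Joins i x y → Joins i y x
  Joins-flip (inj₁ (p , q)) = inj₂ (q , p)
  Joins-flip (inj₂ (p , q)) = inj₁ (q , p)

  joins-sym : ∀ i x y → joins i x y ≡ joins i y x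
  joins-sym i x y = does-⇔ (mk⇔ Joins-flip Joins-flip) (joins? i x y) (joins? i y x)

  joins⇒adj : ∀ i x y → joins i x y ≡ true → adj G x y ≡ true
  joins⇒adj i x y j with from-does (joins? i x y) j
  ... | inj₁ (refl , refl) = edge i
  ... | inj₂ (refl , refl) = trans (sym G (v i) (u i)) (edge i)

  -- Distinct indices give distinct edges: equal orientations are separated by
  -- injectivity, opposite ones are excluded by u_i < v_i.
  joins-unique : ∀ x y i j → joins i x y ≡ true → joins j x y ≡ true → i ≡ j
  joins-unique x y i j p q with from-does (joins? i x y) p | from-does (joins? j x y) q
  ... | inj₁ (refl , refl) | inj₁ (x≡ , y≡) = distinct (cong₂ _,_ x≡ y≡)
  ... | inj₂ (refl , refl) | inj₂ (x≡ , y≡) = distinct (cong₂ _,_ y≡ x≡)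
  ... | inj₁ (refl , refl) | inj₂ (x≡ , y≡) =
    ⊥-elim (ℕₚ.<-asym (u<v j) (subst₂ (λ a b → toℕ a < toℕ b) x≡ y≡ (u<v i)))
  ... | inj₂ (refl , refl) | inj₁ (x≡ , y≡) =
    ⊥-elim (ℕₚ.<-asym (u<v j) (subst₂ (λ a b → toℕ a < toℕ b) y≡ x≡ (u<v i)))

  removed : Fin n → Fin n → ℕ
  removed x y = Σ[ (λ i → joins i x y ⊙ 1) ]

  removed≤1 : ∀ x y → removed x y ≤ 1
  removed≤1 x y = Σ-atMostOne (λ i → joins i x y) (λ i j → joins-unique x y i j)

  removed-sym : ∀ x y → removed x y ≡ removed y x
  removed-sym x y = sum-cong-≗ (λ i → cong (_⊙ 1) (joins-sym i x y))

  A : Fin n ⊎ Fin r → Fin n ⊎ Fin r → Bool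
  A (inj₁ x) (inj₁ y) = adj G x y ∧ does (removed x y ℕ.≟ 0)
  A (inj₁ x) (inj₂ i) = isEnd i x
  A (inj₂ i) (inj₁ y) = isEnd i y
  A (inj₂ i) (inj₂ j) = not (does (i ≟ j))

  A-sym : ∀ a b → A a b ≡ A b a
  A-sym (inj₁ x) (inj₁ y) = cong₂ _∧_ (sym G x y) (cong (λ t → does (t ℕ.≟ 0)) (removed-sym x y))
  A-sym (inj₁ x) (inj₂ i) = refl
  A-sym (inj₂ i) (inj₁ y) = refl
  A-sym (inj₂ i) (inj₂ j) = cong not (does-⇔ (mk⇔ ≡-sym ≡-sym) (i ≟ j) (j ≟ i))

  A-irrefl : ∀ a → A a a ≡ false
  A-irrefl (inj₁ x) = cong (_∧ does (removed x x ℕ.≟ 0)) (irrefl G x)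
  A-irrefl (inj₂ i) = cong not (dec-true (i ≟ i) refl)

  H : Graph (n + r)
  H = record { adj    = λ a b → A (splitAt n a) (splitAt n b)
             ; sym    = λ a b → A-sym (splitAt n a) (splitAt n b)
             ; irrefl = λ a → A-irrefl (splitAt n a) }

  old : Fin n → Fin (n + r)
  old x = x ↑ˡ r

  new : Fin r → Fin (n + r)
  new i = n ↑ʳ i

  nbrSum-split : ∀ a (w : Fin (n + r) → ℕ) →
    nbrSum H a w ≡ Σ[ (λ y → A (splitAt n a) (inj₁ y) ⊙ w (old y)) ]
                   + Σ[ (λ j → A (splitAt n a) (inj₂ j) ⊙ w (new j)) ]
  nbrSum-split a w = trans (Σ-split n (λ b → adj H a b ⊙ w b))
    (cong₂ _+_ (sum-cong-≗ (λ y → cong (λ s → A (splitAt n a) s ⊙ w (old y)) (splitAt-↑ˡ n y r)))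
               (sum-cong-≗ (λ j → cong (λ s → A (splitAt n a) s ⊙ w (new j)) (splitAt-↑ʳ n r j))))

  nbrSum-old : ∀ x (w : Fin (n + r) → ℕ) →
    nbrSum H (old x) w ≡ Σ[ (λ y → A (inj₁ x) (inj₁ y) ⊙ w (old y)) ]
                         + Σ[ (λ j → isEnd j x ⊙ w (new j)) ]
  nbrSum-old x w = trans (nbrSum-split (old x) w)
    (cong (λ s → Σ[ (λ y → A s (inj₁ y) ⊙ w (old y)) ] + Σ[ (λ j → A s (inj₂ j) ⊙ w (new j)) ])
          (splitAt-↑ˡ n x r))

  nbrSum-new : ∀ i (w : Fin (n + r) → ℕ) →
    nbrSum H (new i) w ≡ Σ[ (λ y → isEnd i y ⊙ w (old y)) ]
                         + Σ[ (λ j → not (does (i ≟ j)) ⊙ w (new j)) ]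
  nbrSum-new i w = trans (nbrSum-split (new i) w)
    (cong (λ s → Σ[ (λ y → A s (inj₁ y) ⊙ w (old y)) ] + Σ[ (λ j → A s (inj₂ j) ⊙ w (new j)) ])
          (splitAt-↑ʳ n r i))

  unremoved : ∀ x y → adj G x y ≡ false → removed x y ≡ 0
  unremoved x y ¬xy = Σ-none (λ i → joins i x y) (λ _ → 1)
    (λ i → ¬-not (λ j → not-¬ ¬xy (joins⇒adj i x y j)))

  adj-kept-or-removed : ∀ x y c → adj G x y ⊙ c ≡ (A (inj₁ x) (inj₁ y) ⊙ c) + removed x y * c
  adj-kept-or-removed x y c with adj G x y in xy
  ... | false rewrite unremoved x y xy = refl
  ... | true with removed x y | removed≤1 x y
  ...   | zero          | _ = ≡-sym (ℕₚ.+-identityʳ c)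
  ...   | suc zero      | _ = ≡-sym (ℕₚ.+-identityʳ c)
  ...   | suc (suc _)   | s≤s ()

  Joins⇒IsEnd : ∀ {i x y} → Joins i x y → IsEnd i x
  Joins⇒IsEnd (inj₁ (x≡u , _)) = inj₁ (≡-sym x≡u)
  Joins⇒IsEnd (inj₂ (x≡v , _)) = inj₂ (≡-sym x≡v)

  row-sum : ∀ i x (w : Fin n → ℕ) c → w (u i) ≡ c → w (v i) ≡ c →
    Σ[ (λ y → joins i x y ⊙ w y) ] ≡ isEnd i x ⊙ c
  row-sum i x w c wu wv with isEnd? i x
  ... | yes (inj₁ refl) =
    trans (Σ-single (joins i x) w (v i) partner (dec-true (joins? i x (v i)) (inj₁ (refl , refl))))
          (trans wv (cong (_⊙ c) (≡-sym (dec-true (isEnd? i x) (inj₁ refl)))))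
    where
    partner : ∀ y → joins i (u i) y ≡ true → y ≡ v i
    partner y j with from-does (joins? i (u i) y) j
    ... | inj₁ (_ , y≡v) = y≡v
    ... | inj₂ (u≡v , _) = ⊥-elim (u≢v i u≡v)
  ... | yes (inj₂ refl) =
    trans (Σ-single (joins i x) w (u i) partner (dec-true (joins? i x (u i)) (inj₂ (refl , refl))))
          (trans wu (cong (_⊙ c) (≡-sym (dec-true (isEnd? i x) (inj₂ refl)))))
    where
    partner : ∀ y → joins i (v i) y ≡ true → y ≡ u i
    partner y j with from-does (joins? i (v i) y) j
    ... | inj₁ (v≡u , _) = ⊥-elim (u≢v i (≡-sym v≡u))
    ... | inj₂ (_ , y≡u) = y≡u
  ... | no not-end =
    trans (Σ-none (joins i x) w (λ y → ¬-not (λ j → not-end (Joins⇒IsEnd (from-does (joins? i x y) j)))))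
          (cong (_⊙ c) (≡-sym (dec-false (isEnd? i x) not-end)))

  -- Summing a weight over the deleted neighbours of x: each edge i at x contributes
  -- the value c of the weight on its other end.
  removed-weighted : ∀ x (w : Fin n → ℕ) c → (∀ i → w (u i) ≡ c) → (∀ i → w (v i) ≡ c) →
    Σ[ (λ y → removed x y * w y) ] ≡ Σ[ (λ i → isEnd i x ⊙ c) ]
  removed-weighted x w c wu wv = begin
    Σ[ (λ y → removed x y * w y) ]
      ≡⟨ sum-cong-≗ (λ y → *-distribʳ-sum (w y) (λ i → joins i x y ⊙ 1)) ⟩
    Σ[ (λ y → Σ[ (λ i → (joins i x y ⊙ 1) * w y) ]) ]
      ≡⟨ sum-cong-≗ (λ y → sum-cong-≗ (λ i → ⊙-scale (joins i x y) (w y))) ⟩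
    Σ[ (λ y → Σ[ (λ i → joins i x y ⊙ w y) ]) ]
      ≡⟨ ∑-comm (λ y i → joins i x y ⊙ w y) ⟩
    Σ[ (λ i → Σ[ (λ y → joins i x y ⊙ w y) ]) ]
      ≡⟨ sum-cong-≗ (λ i → row-sum i x w c (wu i) (wv i)) ⟩
    Σ[ (λ i → isEnd i x ⊙ c) ] ∎
    where open ≡-Reasoning

  rerouting : ∀ x (w : Fin n → ℕ) c → (∀ i → w (u i) ≡ c) → (∀ i → w (v i) ≡ c) →
    nbrSum G x w ≡ Σ[ (λ y → A (inj₁ x) (inj₁ y) ⊙ w y) ] + Σ[ (λ i → isEnd i x ⊙ c) ]
  rerouting x w c wu wv = begin
    nbrSum G x w
      ≡⟨ sum-cong-≗ (λ y → adj-kept-or-removed x y (w y)) ⟩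
    Σ[ (λ y → (A (inj₁ x) (inj₁ y) ⊙ w y) + removed x y * w y) ]
      ≡⟨ ∑-distrib-+ (λ y → A (inj₁ x) (inj₁ y) ⊙ w y) (λ y → removed x y * w y) ⟩
    Σ[ (λ y → A (inj₁ x) (inj₁ y) ⊙ w y) ] + Σ[ (λ y → removed x y * w y) ]
      ≡⟨ cong (Σ[ (λ y → A (inj₁ x) (inj₁ y) ⊙ w y) ] +_) (removed-weighted x w c wu wv) ⟩
    Σ[ (λ y → A (inj₁ x) (inj₁ y) ⊙ w y) ] + Σ[ (λ i → isEnd i x ⊙ c) ] ∎
    where open ≡-Reasoning

  vertex-cases : ∀ a → (Σ (Fin n) λ x → old x ≡ a) ⊎ (Σ (Fin r) λ j → new j ≡ a)
  vertex-cases a with splitAt n a in eq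
  ... | inj₁ x = inj₁ (x , splitAt⁻¹-↑ˡ eq)
  ... | inj₂ j = inj₂ (j , splitAt⁻¹-↑ʳ eq)

  adj-old-new : ∀ x i → adj H (old x) (new i) ≡ isEnd i x
  adj-old-new x i = cong₂ A (splitAt-↑ˡ n x r) (splitAt-↑ʳ n r i)

  adj-new-old : ∀ i y → adj H (new i) (old y) ≡ isEnd i y
  adj-new-old i y = cong₂ A (splitAt-↑ʳ n r i) (splitAt-↑ˡ n y r)

  deg-old : ∀ x → deg H (old x) ≡ deg G x
  deg-old x = trans (nbrSum-old x (λ _ → 1)) (≡-sym (rerouting x (λ _ → 1) 1 (λ _ → refl) (λ _ → refl)))

  ends-count : ∀ i → Σ[ (λ y → isEnd i y ⊙ 1) ] ≡ 2
  ends-count i = begin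
    Σ[ (λ y → isEnd i y ⊙ 1) ]
      ≡⟨ sum-cong-≗ (λ y → ∨-⊙-disjoint (does (u i ≟ y)) (does (v i ≟ y)) (not-both y)) ⟩
    Σ[ (λ y → (does (u i ≟ y) ⊙ 1) + (does (v i ≟ y) ⊙ 1)) ]
      ≡⟨ ∑-distrib-+ (λ y → does (u i ≟ y) ⊙ 1) (λ y → does (v i ≟ y) ⊙ 1) ⟩
    Σ[ (λ y → does (u i ≟ y) ⊙ 1) ] + Σ[ (λ y → does (v i ≟ y) ⊙ 1) ]
      ≡⟨ cong₂ _+_ (Σ-point (u i)) (Σ-point (v i)) ⟩
    2 ∎
    where
    open ≡-Reasoning
    not-both : ∀ y → does (u i ≟ y) ≡ true → does (v i ≟ y) ≡ true → ⊥
    not-both y p q = u≢v i (trans (from-does (u i ≟ y) p) (≡-sym (from-does (v i ≟ y) q)))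

  -- A new vertex has degree 2 + (r - 1) = r + 1.
  deg-new : ∀ i → deg H (new i) ≡ suc r
  deg-new i = trans (nbrSum-new i (λ _ → 1))
    (trans (cong (_+ Σ[ (λ j → not (does (i ≟ j)) ⊙ 1) ]) (ends-count i)) (cong suc (Σ-others i)))

  new-edge : ∀ i → adj H (old (u i)) (new i) ≡ true
  new-edge i = trans (adj-old-new (u i) i) (dec-true (isEnd? i (u i)) (inj₁ refl))

  new-edge-ordered : ∀ i → toℕ (old (u i)) < toℕ (new i)
  new-edge-ordered i = subst₂ _<_ (≡-sym (toℕ-↑ˡ (u i) r)) (≡-sym (toℕ-↑ʳ n i))
    (ℕₚ.<-≤-trans (toℕ<n (u i)) (ℕₚ.m≤m+n n (toℕ i)))

  module _ (harmonic : Harmonic (suc r) G)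
           (deg-u : ∀ i → deg G (u i) ≡ suc r) (deg-v : ∀ i → deg G (v i) ≡ suc r) where

    harmonic-old : ∀ x → nbrDegSum H (old x) ≡ suc r * deg H (old x)
    harmonic-old x = begin
      nbrSum H (old x) (deg H)
        ≡⟨ nbrSum-old x (deg H) ⟩
      Σ[ (λ y → A (inj₁ x) (inj₁ y) ⊙ deg H (old y)) ] + Σ[ (λ j → isEnd j x ⊙ deg H (new j)) ]
        ≡⟨ cong₂ _+_ (sum-cong-≗ (λ y → cong (A (inj₁ x) (inj₁ y) ⊙_) (deg-old y)))
                     (sum-cong-≗ (λ j → cong (isEnd j x ⊙_) (deg-new j))) ⟩
      Σ[ (λ y → A (inj₁ x) (inj₁ y) ⊙ deg G y) ] + Σ[ (λ j → isEnd j x ⊙ suc r) ]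
        ≡⟨ ≡-sym (rerouting x (deg G) (suc r) deg-u deg-v) ⟩
      nbrDegSum G x
        ≡⟨ harmonic x ⟩
      suc r * deg G x
        ≡⟨ cong (suc r *_) (≡-sym (deg-old x)) ⟩
      suc r * deg H (old x) ∎
      where open ≡-Reasoning

    -- All neighbours of a new vertex have degree r + 1.
    harmonic-new : ∀ i → nbrDegSum H (new i) ≡ suc r * deg H (new i)
    harmonic-new i = nbrDegSum-constant H (new i) (suc r) nbr-degree
      where
      nbr-degree : ∀ b → adj H (new i) b ≡ true → deg H b ≡ suc r
      nbr-degree b adjacent with vertex-cases b
      ... | inj₂ (j , refl) = deg-new j
      ... | inj₁ (y , refl) with from-does (isEnd? i y) (trans (≡-sym (adj-new-old i y)) adjacent)
      ...   | inj₁ refl = trans (deg-old (u i)) (deg-u i)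
      ...   | inj₂ refl = trans (deg-old (v i)) (deg-v i)

    harmonic-H : Harmonic (suc r) H
    harmonic-H a with vertex-cases a
    ... | inj₁ (x , refl) = harmonic-old x
    ... | inj₂ (j , refl) = harmonic-new j

  noIsolated-H : NoIsolated G → NoIsolated H
  noIsolated-H noIsolated a with vertex-cases a
  ... | inj₁ (x , refl) = subst (1 ≤_) (≡-sym (deg-old x)) (noIsolated x)
  ... | inj₂ (j , refl) = subst (1 ≤_) (≡-sym (deg-new j)) (s≤s z≤n)

  -- Old vertices keep their degrees, so H is regular only if G is.
  nonRegular-H : ∀ k → ¬ Regular k G → ¬ Regular k H
  nonRegular-H k nonRegular regular = nonRegular (λ x → trans (≡-sym (deg-old x)) (regular (old x)))

  newEdges-H : (∀ i → deg G (u i) ≡ suc r) → HasDistinctDegKEdges r (suc r) H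
  newEdges-H deg-u = newEdge , λ {i} {j} same → ↑ʳ-injective n i j (cong proj₂ same)
    where
    newEdge : Fin r → DegKEdge (suc r) H
    newEdge i = old (u i) , new i , new-edge-ordered i , new-edge i , trans (deg-old (u i)) (deg-u i) , deg-new i

-- A pseudo (r+1)-regular graph with r distinct edges between vertices of degree
-- r + 1: the hypothesis of the theorem, which the expansion reproduces.
Expandable : ℕ → ∀ {t} → Graph t → Set
Expandable r G = PseudoRegular (suc r) G × HasDistinctDegKEdges r (suc r) G

expand : ∀ r {t} → Σ (Graph t) (Expandable r) → Σ (Graph (t + r)) (Expandable r)
expand r (G , (noIsolated , harmonic , nonRegular) , (e , distinct)) =
  H , (noIsolated-H noIsolated , harmonic-H harmonic deg-u deg-v , nonRegular-H (suc r) nonRegular) ,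
      newEdges-H deg-u
  where
  u v : Fin r → Fin _
  u i = proj₁ (e i)
  v i = proj₁ (proj₂ (e i))
  open Expansion G u v (λ i → proj₁ (proj₂ (proj₂ (e i)))) (λ i → proj₁ (proj₂ (proj₂ (proj₂ (e i))))) distinct
  deg-u : ∀ i → deg G (u i) ≡ suc r
  deg-u i = proj₁ (proj₂ (proj₂ (proj₂ (proj₂ (e i)))))
  deg-v : ∀ i → deg G (v i) ≡ suc r
  deg-v i = proj₂ (proj₂ (proj₂ (proj₂ (proj₂ (e i)))))

expand-iterated : ∀ r n → Σ (Graph n) (Expandable r) → ∀ m → Σ (Graph (n + m * r)) (Expandable r)
expand-iterated r n G zero    = subst (λ t → Σ (Graph t) (Expandable r)) (≡-sym (ℕₚ.+-identityʳ n)) G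
expand-iterated r n G (suc m) = subst (λ t → Σ (Graph t) (Expandable r)) size (expand r (expand-iterated r n G m))
  where
  size : n + m * r + r ≡ n + suc m * r
  size = trans (ℕₚ.+-assoc n (m * r) r) (cong (n +_) (ℕₚ.+-comm (m * r) r))

lemma5p1 : (k n : ℕ) → 2 ≤ k →
    (Σ (Graph n) λ G → PseudoRegular k G × HasDistinctDegKEdges (k ∸ 1) k G) →
    (m : ℕ) → 1 ≤ m →
    Σ (Graph (n + m * (k ∸ 1))) λ H → PseudoRegular k H
lemma5p1 zero    n () G m _
lemma5p1 (suc r) n _  G m _ = proj₁ H , proj₁ (proj₂ H)
  where
  H : Σ (Graph (n + m * r)) (Expandable r)
  H = expand-iterated r n G m
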